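{- There exists a constant $C>0$ such that for all sufficiently large $n$, $$f_3(n) \ge \Big(1+\frac15\Big)\binom{n-1}{2} - Cn.$$
   Context: For $\ell \ge 4$, the tight $3$-uniform $\ell$-cycle $TC_\ell^3$ is the $3$-uniform hypergraph on $\ell$ distinct vertices $v_0,\dots,v_{\ell-1}$ with edges $\{v_i,v_{i+1},v_{i+2}\}$ (subscripts mod $\ell$). A $3$-uniform hypergraph is tight-cycle-free if it contains no subhypergraph isomorphic to $TC_\ell^3$ for any $\ell\ge 4$. $f_3(n)$ denotes the maximum number of edges in a tight-cycle-free $3$-uniform hypergraph on $n$ vertices. -}

module Defs where

open import Data.Nat using (ℕ; suc; _+_; _*_; _∸_; _≤_; _<_)
open import Data.Nat.DivMod using (_mod_)
open import Data.Nat.Combinatorics using (_C_)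
open import Data.Fin using (Fin; toℕ)
open import Data.Product using (Σ; _×_; _,_)
open import Data.Sum using (_⊎_)
open import Data.List using (List; length)
open import Data.List.Relation.Unary.All using (All)
open import Data.List.Relation.Unary.Any using (Any)
open import Data.List.Relation.Unary.Unique.Propositional using (Unique)
open import Relation.Binary.PropositionalEquality using (_≡_; _≢_)
open import Relation.Nullary using (¬_)
open import Function.Definitions using (Injective)

-- A 3-set {a,b,c} ⊆ Fin n is encoded canonically as a triple with a < b < c.
Triple : ℕ → Set
Triple n = Fin n × Fin n × Fin n

Sorted3 : ∀ {n} → Triple n → Set
Sorted3 (a , b , c) = toℕ a < toℕ b × toℕ b < toℕ c

record Hypergraph3 (n : ℕ) : Set where
  constructor hg
  field
    edges  : List (Triple n)
    sorted : All Sorted3 edges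
    unique : Unique edges
open Hypergraph3 public

numEdges : ∀ {n} → Hypergraph3 n → ℕ
numEdges H = length (edges H)

InTriple : ∀ {n} → Fin n → Triple n → Set
InTriple x (a , b , c) = x ≡ a ⊎ x ≡ b ⊎ x ≡ c

IsEdge : ∀ {n} → Hypergraph3 n → Fin n → Fin n → Fin n → Set
IsEdge H x y z =
  x ≢ y × y ≢ z × x ≢ z ×
  Any (λ e → InTriple x e × InTriple y e × InTriple z e) (edges H)

-- H contains a copy of the tight cycle TC_ℓ with ℓ = 4 + k: distinct vertices
-- v_0,…,v_{ℓ-1} with {v_i, v_{i+1}, v_{i+2}} ∈ H for all i (indices mod ℓ).
ContainsTightCycle : ∀ {n} → Hypergraph3 n → ℕ → Set
ContainsTightCycle {n} H k =
  Σ (Fin (4 + k) → Fin n) λ v →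
    Injective _≡_ _≡_ v ×
    ((i : Fin (4 + k)) →
      IsEdge H (v i) (v ((toℕ i + 1) mod (4 + k))) (v ((toℕ i + 2) mod (4 + k))))

TightCycleFree : ∀ {n} → Hypergraph3 n → Set
TightCycleFree H = ∀ k → ¬ ContainsTightCycle H k

-- "f₃(n) ≥ m": some tight-cycle-free 3-graph on n vertices has at least m edges.
-- (f₃(n) is the maximum edge count, so this is exactly the meaning of f₃(n) ≥ m.)
f₃≥ : ℕ → ℕ → Set
f₃≥ n m = Σ (Hypergraph3 n) λ H → TightCycleFree H × m ≤ numEdges H

-- For a parameter t use the labels 0 … 4t+1: the star
-- centre 0; the low labels 1 … 2t, perfectly matched by the pairs
-- {2j+1, 2j+2}; and the high labels 2t+1 … 4t+1, the first of which is the
-- hub.  The edges are the star edges {0, q, r} with q, r not a matched pair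
-- and not both high, the pair edges {2j+1, 2j+2, h} with h high, and the
-- hub edges {hub, h, h′} with h, h′ high.
--
-- Tight-cycle-freeness (module TightCycle) uses only these shapes: two
-- adjacent high vertices of a tight cycle would make every later window a
-- hub edge, repeating the hub; so every window avoiding 0 is a pair edge;
-- three consecutive pair edges are impossible; and a 0 on the cycle is ruled
-- out separately for lengths 4, 5 and ≥ 6.
--
-- The edges are listed row by row (omitting the t star edges
-- {0, 2j+2, 2j+3}, which keeps every row an interval), giving 10t² − t
-- distinct edges.  On n = m + 2 vertices with t = ⌊m/4⌋ this beats
-- (6/5)·C(n-1,2) − 10·n by a polynomial inequality.
module Submission where

open import Defs

open import Data.Nat using (ℕ; zero; suc; _+_; _*_; _∸_; _≤_; _<_; z≤n; s≤s; s≤s⁻¹; pred; NonZero; _<?_)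
open import Data.Nat.DivMod using (_mod_; _%_; _/_; m<n⇒m%n≡m; %-distribˡ-+; [m+n]%n≡m%n; m%n%n≡m%n; m%n<n; m≤n⇒[n∸m]%m≡n%m; m≡m%n+[m/n]*n; m/n*n≤m)
open import Data.Nat.Combinatorics using (_C_; nC1≡n; nCk+nC[k+1]≡[n+1]C[k+1])
open import Data.Fin using (Fin; toℕ)
open import Data.Fin.Properties using (toℕ-injective; toℕ-fromℕ<)
open import Data.Nat.Properties
open import Data.Nat.ListAction using (sum)
open import Data.Nat.ListAction.Properties using (sum-++)
open import Data.Nat.Solver using (module +-*-Solver)
open import Data.List using (List; []; _∷_; _++_; [_]; applyUpTo; length; map; concatMap)
open import Data.List.Properties using (length-++; length-map; length-applyUpTo; map-++; map-applyUpTo; applyUpTo-∷ʳ)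
open import Data.List.Relation.Unary.All using (All; []; _∷_)
import Data.List.Relation.Unary.All as All
import Data.List.Relation.Unary.All.Properties as All
open import Data.List.Relation.Unary.AllPairs using (AllPairs; []; _∷_)
import Data.List.Relation.Unary.AllPairs.Properties as AllPairs
import Data.List.Relation.Unary.Any.Properties as Any
open import Data.List.Relation.Unary.Unique.Propositional using (Unique)
import Data.List.Relation.Unary.Unique.Propositional.Properties as Unique
open import Data.Product using (Σ; _×_; _,_; proj₁; proj₂)
open import Data.Sum using (_⊎_; inj₁; inj₂)
import Data.Sum as Sum
open import Data.Empty using (⊥; ⊥-elim)
open import Relation.Nullary using (¬_; yes; no)
open import Relation.Binary.PropositionalEquality hiding ([_])

record Low (t p : ℕ) : Set where
  constructor low
  field
    positive : 0 < p
    atMost2t : p ≤ 2 * t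

record High (t p : ℕ) : Set where
  constructor high
  field
    above2t : 2 * t < p

hub : ℕ → ℕ
hub t = suc (2 * t)

high-hub : ∀ t → High t (hub t)
high-hub t = high ≤-refl

high≢0 : ∀ {t p} → High t p → p ≢ 0
high≢0 (high ()) refl

low≢0 : ∀ {t p} → Low t p → p ≢ 0
low≢0 (low () _) refl

high-not-low : ∀ {t p} → High t p → ¬ Low t p
high-not-low (high 2t<p) (low _ p≤2t) = <⇒≱ 2t<p p≤2t

Mate : ℕ → ℕ → ℕ → Set
Mate t p q = Σ ℕ λ j → j < t ×
  (p ≡ suc (2 * j) × q ≡ suc (suc (2 * j)) ⊎ p ≡ suc (suc (2 * j)) × q ≡ suc (2 * j))

mate-sym : ∀ {t p q} → Mate t p q → Mate t q p
mate-sym (j , j<t , inj₁ (p≡ , q≡)) = j , j<t , inj₂ (q≡ , p≡)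
mate-sym (j , j<t , inj₂ (p≡ , q≡)) = j , j<t , inj₁ (q≡ , p≡)

mate-unique : ∀ {t p q q′} → Mate t p q → Mate t p q′ → q ≡ q′
mate-unique (_ , _ , inj₁ (p≡ , q≡)) (_ , _ , inj₁ (p≡′ , q≡′)) =
  trans q≡ (trans (cong suc (trans (sym p≡) p≡′)) (sym q≡′))
mate-unique (_ , _ , inj₂ (p≡ , q≡)) (_ , _ , inj₂ (p≡′ , q≡′)) =
  trans q≡ (trans (cong pred (trans (sym p≡) p≡′)) (sym q≡′))
mate-unique (j , _ , inj₁ (p≡ , _)) (j′ , _ , inj₂ (p≡′ , _)) =
  ⊥-elim (even≢odd j j′ (suc-injective (trans (sym p≡) p≡′)))
mate-unique (j , _ , inj₂ (p≡ , _)) (j′ , _ , inj₁ (p≡′ , _)) =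
  ⊥-elim (even≢odd j′ j (suc-injective (trans (sym p≡′) p≡)))

pair-top : ∀ {t j} → j < t → suc (suc (2 * j)) ≤ 2 * t
pair-top {t} {j} j<t = subst (_≤ 2 * t) (*-suc 2 j) (*-monoʳ-≤ 2 j<t)

mate-low : ∀ {t p q} → Mate t p q → Low t p
mate-low (j , j<t , inj₁ (refl , _)) = low (s≤s z≤n) (≤-trans (n≤1+n _) (pair-top j<t))
mate-low (j , j<t , inj₂ (refl , _)) = low (s≤s z≤n) (pair-top j<t)

mate-not-high : ∀ {t p q} → Mate t p q → ¬ High t p
mate-not-high m h = high-not-low h (mate-low m)

mate-close : ∀ {t p q} → Mate t p q → q ≤ suc p
mate-close (_ , _ , inj₁ (refl , refl)) = ≤-refl
mate-close (_ , _ , inj₂ (refl , refl)) = m≤n⇒m≤1+n (n≤1+n _)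

-- Two labels that may lie together with the star centre 0 in an edge:
-- they are not mates, and not both high.
Link : ℕ → ℕ → ℕ → Set
Link t q r = ¬ Mate t q r × ¬ (High t q × High t r)

link-sym : ∀ {t q r} → Link t q r → Link t r q
link-sym (not-mates , not-highs) = (λ m → not-mates (mate-sym m)) , (λ (h , h′) → not-highs (h′ , h))

OneOf : ℕ → ℕ → ℕ → ℕ → Set
OneOf x a b c = x ≡ a ⊎ x ≡ b ⊎ x ≡ c

oneOf-rotate : ∀ {x a b c} → OneOf x a b c → OneOf x b c a
oneOf-rotate (inj₁ e)        = inj₂ (inj₂ e)
oneOf-rotate (inj₂ (inj₁ e)) = inj₁ e
oneOf-rotate (inj₂ (inj₂ e)) = inj₂ (inj₁ e)

oneOf-swap : ∀ {x a b c} → OneOf x a b c → OneOf x b a c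
oneOf-swap (inj₁ e)        = inj₂ (inj₁ e)
oneOf-swap (inj₂ (inj₁ e)) = inj₁ e
oneOf-swap (inj₂ (inj₂ e)) = inj₂ (inj₂ e)

oneOf-remaining : ∀ {x a b c} → OneOf x a b c → a ≢ x → b ≢ x → x ≡ c
oneOf-remaining (inj₁ x≡a)        a≢x _   = ⊥-elim (a≢x (sym x≡a))
oneOf-remaining (inj₂ (inj₁ x≡b)) _   b≢x = ⊥-elim (b≢x (sym x≡b))
oneOf-remaining (inj₂ (inj₂ x≡c)) _   _   = x≡c

-- The edges of the construction, read in a given order (p, q, r).  There
-- are three kinds, each listed by the position of its distinguished label
-- (positions are counted cyclically, so rotating a window is trivial):
--   star edges {0, q, r} with q, r linked,
--   the hub edges: three high labels, one of them the hub,
--   pair edges {h, m, m′}: a high label together with a matched pair.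
data Window (t p q r : ℕ) : Set where
  star₁ : p ≡ 0 → Link t q r → Window t p q r
  star₂ : q ≡ 0 → Link t r p → Window t p q r
  star₃ : r ≡ 0 → Link t p q → Window t p q r
  hub-edge : High t p → High t q → High t r → OneOf (hub t) p q r → Window t p q r
  pair₁ : High t p → Mate t q r → Window t p q r
  pair₂ : High t q → Mate t r p → Window t p q r
  pair₃ : High t r → Mate t p q → Window t p q r

window-rotate : ∀ {t p q r} → Window t p q r → Window t q r p
window-rotate (star₁ z l)           = star₃ z l
window-rotate (star₂ z l)           = star₁ z l
window-rotate (star₃ z l)           = star₂ z l
window-rotate (hub-edge hp hq hr c) = hub-edge hq hr hp (oneOf-rotate c)
window-rotate (pair₁ h m)           = pair₃ h m
window-rotate (pair₂ h m)           = pair₁ h m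
window-rotate (pair₃ h m)           = pair₂ h m

window-swap : ∀ {t p q r} → Window t p q r → Window t q p r
window-swap (star₁ z l)           = star₂ z (link-sym l)
window-swap (star₂ z l)           = star₁ z (link-sym l)
window-swap (star₃ z l)           = star₃ z (link-sym l)
window-swap (hub-edge hp hq hr c) = hub-edge hq hp hr (oneOf-swap c)
window-swap (pair₁ h m)           = pair₂ h (mate-sym m)
window-swap (pair₂ h m)           = pair₁ h (mate-sym m)
window-swap (pair₃ h m)           = pair₃ h (mate-sym m)

window-reorder : ∀ {t p q r a b c} → Window t a b c → p ≢ q → q ≢ r → p ≢ r →
                 OneOf p a b c → OneOf q a b c → OneOf r a b c → Window t p q r
window-reorder _ p≢q _ _ (inj₁ refl)        (inj₁ refl)        _ = ⊥-elim (p≢q refl)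
window-reorder _ p≢q _ _ (inj₂ (inj₁ refl)) (inj₂ (inj₁ refl)) _ = ⊥-elim (p≢q refl)
window-reorder _ p≢q _ _ (inj₂ (inj₂ refl)) (inj₂ (inj₂ refl)) _ = ⊥-elim (p≢q refl)
window-reorder W _ q≢r p≢r (inj₁ refl) (inj₂ (inj₁ refl)) r∈ =
  subst (Window _ _ _) (sym (oneOf-remaining r∈ p≢r q≢r)) W
window-reorder W _ q≢r p≢r (inj₁ refl) (inj₂ (inj₂ refl)) r∈ =
  subst (Window _ _ _) (sym (oneOf-remaining (oneOf-rotate (oneOf-rotate r∈)) q≢r p≢r))
        (window-swap (window-rotate (window-rotate W)))
window-reorder W _ q≢r p≢r (inj₂ (inj₁ refl)) (inj₁ refl) r∈ =
  subst (Window _ _ _) (sym (oneOf-remaining r∈ q≢r p≢r)) (window-swap W)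
window-reorder W _ q≢r p≢r (inj₂ (inj₁ refl)) (inj₂ (inj₂ refl)) r∈ =
  subst (Window _ _ _) (sym (oneOf-remaining (oneOf-rotate r∈) p≢r q≢r)) (window-rotate W)
window-reorder W _ q≢r p≢r (inj₂ (inj₂ refl)) (inj₁ refl) r∈ =
  subst (Window _ _ _) (sym (oneOf-remaining (oneOf-rotate (oneOf-rotate r∈)) p≢r q≢r))
        (window-rotate (window-rotate W))
window-reorder W _ q≢r p≢r (inj₂ (inj₂ refl)) (inj₂ (inj₁ refl)) r∈ =
  subst (Window _ _ _) (sym (oneOf-remaining (oneOf-rotate r∈) q≢r p≢r))
        (window-swap (window-rotate W))

window-link : ∀ {t p q r} → Window t p q r → p ≡ 0 → p ≢ q → p ≢ r → Link t q r
window-link (star₁ _ l)          _  _   _   = l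
window-link (star₂ q≡0 _)        p≡0 p≢q _   = ⊥-elim (p≢q (trans p≡0 (sym q≡0)))
window-link (star₃ r≡0 _)        p≡0 _   p≢r = ⊥-elim (p≢r (trans p≡0 (sym r≡0)))
window-link (hub-edge hp _ _ _)  p≡0 _   _   = ⊥-elim (high≢0 hp p≡0)
window-link (pair₁ hp _)         p≡0 _   _   = ⊥-elim (high≢0 hp p≡0)
window-link (pair₂ _ m)          p≡0 _   _   = ⊥-elim (low≢0 (mate-low (mate-sym m)) p≡0)
window-link (pair₃ _ m)          p≡0 _   _   = ⊥-elim (low≢0 (mate-low m) p≡0)

window-highs : ∀ {t p q r} → Window t p q r → High t p → High t q →
               High t r × OneOf (hub t) p q r
window-highs (star₁ p≡0 _)         hp _  = ⊥-elim (high≢0 hp p≡0)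
window-highs (star₂ q≡0 _)         _  hq = ⊥-elim (high≢0 hq q≡0)
window-highs (star₃ _ (_ , not-highs)) hp hq = ⊥-elim (not-highs (hp , hq))
window-highs (hub-edge _ _ hr c)   _  _  = hr , c
window-highs (pair₁ _ m)           _  hq = ⊥-elim (mate-not-high m hq)
window-highs (pair₂ _ m)           hp _  = ⊥-elim (mate-not-high (mate-sym m) hp)
window-highs (pair₃ _ m)           hp _  = ⊥-elim (mate-not-high m hp)

data PairWindow (t p q r : ℕ) : Set where
  high₁ : High t p → Mate t q r → PairWindow t p q r
  high₂ : High t q → Mate t r p → PairWindow t p q r
  high₃ : High t r → Mate t p q → PairWindow t p q r

window-pair : ∀ {t p q r} → Window t p q r → p ≢ 0 → q ≢ 0 → r ≢ 0 →
              ¬ (High t p × High t q) → PairWindow t p q r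
window-pair (star₁ p≡0 _)        p≢0 _   _   _ = ⊥-elim (p≢0 p≡0)
window-pair (star₂ q≡0 _)        _   q≢0 _   _ = ⊥-elim (q≢0 q≡0)
window-pair (star₃ r≡0 _)        _   _   r≢0 _ = ⊥-elim (r≢0 r≡0)
window-pair (hub-edge hp hq _ _) _   _   _   not-highs = ⊥-elim (not-highs (hp , hq))
window-pair (pair₁ h m)          _   _   _   _ = high₁ h m
window-pair (pair₂ h m)          _   _   _   _ = high₂ h m
window-pair (pair₃ h m)          _   _   _   _ = high₃ h m

length-cases : ∀ k → k ≡ 0 ⊎ k ≡ 1 ⊎ 2 ≤ k
length-cases zero          = inj₁ refl
length-cases (suc zero)    = inj₂ (inj₁ refl)
length-cases (suc (suc k)) = inj₂ (inj₂ (s≤s (s≤s z≤n)))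

-- A tight cycle of length 4 + k, given by its labels w 0, w 1, … read
-- periodically: consecutive triples are edges, and labels less than a
-- full period apart are distinct.  No such cycle exists.
module TightCycle (t k : ℕ) (w : ℕ → ℕ)
  (window   : ∀ i → Window t (w i) (w (1 + i)) (w (2 + i)))
  (distinct : ∀ i d → 0 < d → d < 4 + k → w i ≢ w (d + i))
  (periodic : ∀ i → w (4 + k + i) ≡ w i) where

  apart₁ : ∀ i → w i ≢ w (1 + i)
  apart₁ i = distinct i 1 (s≤s z≤n) (s≤s (s≤s z≤n))

  apart₂ : ∀ i → w i ≢ w (2 + i)
  apart₂ i = distinct i 2 (s≤s z≤n) (s≤s (s≤s (s≤s z≤n)))

  apart₃ : ∀ i → w i ≢ w (3 + i)
  apart₃ i = distinct i 3 (s≤s z≤n) (s≤s (s≤s (s≤s (s≤s z≤n))))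

  -- The hub occurs only once, so it is not among the three labels after it.
  hub-once : ∀ i → hub t ≡ w i → ¬ OneOf (hub t) (w (1 + i)) (w (2 + i)) (w (3 + i))
  hub-once i e (inj₁ e′)        = apart₁ i (trans (sym e) e′)
  hub-once i e (inj₂ (inj₁ e′)) = apart₂ i (trans (sym e) e′)
  hub-once i e (inj₂ (inj₂ e′)) = apart₃ i (trans (sym e) e′)

  hub-run : ∀ i → High t (w i) → High t (w (1 + i)) →
            High t (w (2 + i)) × OneOf (hub t) (w i) (w (1 + i)) (w (2 + i))
  hub-run i = window-highs (window i)

  -- So two adjacent high labels would put the hub into four consecutive
  -- windows, hence twice within four consecutive positions.
  no-adjacent-highs : ∀ i → High t (w i) → High t (w (1 + i)) → ⊥
  no-adjacent-highs i h₀ h₁ =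
    let h₂ , hub₀ = hub-run i h₀ h₁
        h₃ , hub₁ = hub-run (1 + i) h₁ h₂
        h₄ , hub₂ = hub-run (2 + i) h₂ h₃
        _  , hub₃ = hub-run (3 + i) h₃ h₄
    in hub-twice hub₀ hub₁ hub₂ hub₃
    where
    hub-twice : OneOf (hub t) (w i) (w (1 + i)) (w (2 + i)) →
                OneOf (hub t) (w (1 + i)) (w (2 + i)) (w (3 + i)) →
                OneOf (hub t) (w (2 + i)) (w (3 + i)) (w (4 + i)) →
                OneOf (hub t) (w (3 + i)) (w (4 + i)) (w (5 + i)) → ⊥
    hub-twice (inj₁ e)        c₁ _  _  = hub-once i e c₁
    hub-twice (inj₂ (inj₁ e)) _  c₂ _  = hub-once (1 + i) e c₂
    hub-twice (inj₂ (inj₂ e)) _  _  c₃ = hub-once (2 + i) e c₃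

  pair-window : ∀ i → w i ≢ 0 → w (1 + i) ≢ 0 → w (2 + i) ≢ 0 →
                PairWindow t (w i) (w (1 + i)) (w (2 + i))
  pair-window i n₀ n₁ n₂ = window-pair (window i) n₀ n₁ n₂ (λ (h₀ , h₁) → no-adjacent-highs i h₀ h₁)

  consecutive-pairs : ∀ i → PairWindow t (w i) (w (1 + i)) (w (2 + i)) →
                      PairWindow t (w (1 + i)) (w (2 + i)) (w (3 + i)) →
                      High t (w i) × Mate t (w (1 + i)) (w (2 + i)) × High t (w (3 + i))
  consecutive-pairs i (high₁ h m) (high₃ h′ _)  = h , m , h′
  consecutive-pairs i (high₁ _ m) (high₁ h′ _)  = ⊥-elim (mate-not-high m h′)
  consecutive-pairs i (high₁ _ m) (high₂ h′ _)  = ⊥-elim (mate-not-high (mate-sym m) h′)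
  consecutive-pairs i (high₂ _ m) (high₁ _ m′)  = ⊥-elim (apart₃ i (mate-unique m m′))
  consecutive-pairs i (high₂ _ m) (high₂ h′ _)  = ⊥-elim (mate-not-high m h′)
  consecutive-pairs i (high₂ h _) (high₃ _ m′)  = ⊥-elim (mate-not-high m′ h)
  consecutive-pairs i (high₃ _ m) (high₁ h′ _)  = ⊥-elim (mate-not-high (mate-sym m) h′)
  consecutive-pairs i (high₃ _ m) (high₂ _ m′)  = ⊥-elim (apart₃ i (mate-unique (mate-sym m) (mate-sym m′)))
  consecutive-pairs i (high₃ h _) (high₃ _ m′)  = ⊥-elim (mate-not-high (mate-sym m′) h)

  -- Three consecutive pair edges are impossible: w (3 + i) would be both high and matched.
  three-pairs : ∀ i → PairWindow t (w i) (w (1 + i)) (w (2 + i)) →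
                PairWindow t (w (1 + i)) (w (2 + i)) (w (3 + i)) →
                PairWindow t (w (2 + i)) (w (3 + i)) (w (4 + i)) → ⊥
  three-pairs i P₀ P₁ P₂ =
    let _ , _ , high-at-3 = consecutive-pairs i P₀ P₁
        _ , mated-at-3 , _ = consecutive-pairs (1 + i) P₁ P₂
    in mate-not-high (mate-sym mated-at-3) high-at-3

  link-after : ∀ i → w i ≡ 0 → Link t (w (1 + i)) (w (2 + i))
  link-after i z = window-link (window i) z (apart₁ i) (apart₂ i)

  link-around : ∀ i → w (1 + i) ≡ 0 → Link t (w (2 + i)) (w i)
  link-around i z = window-link (window-rotate (window i)) z (apart₁ (1 + i)) (λ e → apart₁ i (sym e))

  link-before : ∀ i → w (2 + i) ≡ 0 → Link t (w i) (w (1 + i))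
  link-before i z = window-link (window-rotate (window-rotate (window i))) z
                      (λ e → apart₂ i (sym e)) (λ e → apart₁ (1 + i) (sym e))

  pair-after-zero : ∀ p → w p ≡ 0 → ∀ d → 0 < d → 2 + d < 4 + k →
                    PairWindow t (w (d + p)) (w (1 + d + p)) (w (2 + d + p))
  pair-after-zero p z d 0<d 2+d<ℓ =
    pair-window (d + p) (nonzero d 0<d (≤-trans (m≤n+m (suc d) 2) 2+d<ℓ))
                        (nonzero (1 + d) (s≤s z≤n) (≤-trans (m≤n+m (2 + d) 1) 2+d<ℓ))
                        (nonzero (2 + d) (s≤s z≤n) 2+d<ℓ)
    where
    nonzero : ∀ e → 0 < e → e < 4 + k → w (e + p) ≢ 0
    nonzero e 0<e e<ℓ w≡0 = distinct p e 0<e e<ℓ (trans z (sym w≡0))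

  3<ℓ : 3 < 4 + k
  3<ℓ = s≤s (s≤s (s≤s (s≤s z≤n)))

  period-of : ∀ {k′} → k ≡ k′ → ∀ i → w (4 + k′ + i) ≡ w i
  period-of k≡k′ i = subst (λ k → w (4 + k + i) ≡ w i) k≡k′ (periodic i)

  -- Length 4: the window after a 0 is a pair edge, but each of its pairs
  -- also lies in a window through that 0, so it is linked, not matched.
  zero-in-4-cycle : k ≡ 0 → ∀ p → w p ≢ 0
  zero-in-4-cycle k≡0 p z with pair-after-zero p z 1 (s≤s z≤n) 3<ℓ
  ... | high₁ _ m = proj₁ (link-before (2 + p) (trans (period-of k≡0 p) z)) m
  ... | high₂ _ m = proj₁ (link-around (3 + p) (trans (period-of k≡0 p) z))
                      (subst (λ x → Mate t x (w (3 + p))) (sym (period-of k≡0 (1 + p))) (mate-sym m))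
  ... | high₃ _ m = proj₁ (link-after p z) m

  -- Length 5: the two windows after a 0 are pair edges, which makes both
  -- neighbours of the 0 high; but they are linked through the 0.
  zero-in-5-cycle : k ≡ 1 → ∀ p → w p ≢ 0
  zero-in-5-cycle k≡1 p z =
    let h₁ , _ , h₄ = consecutive-pairs (1 + p) (pair-after-zero p z 1 (s≤s z≤n) 3<ℓ)
                                                (pair-after-zero p z 2 (s≤s z≤n) 4<ℓ)
    in proj₂ (link-around (4 + p) (trans (period-of k≡1 p) z))
             (subst (High t) (sym (period-of k≡1 (1 + p))) h₁ , h₄)
    where
    4<ℓ : 4 < 4 + k
    4<ℓ = subst (λ k → 4 < 4 + k) (sym k≡1) ≤-refl

  -- Length ≥ 6: the three windows after a 0 are pair edges.
  zero-in-long-cycle : 2 ≤ k → ∀ p → w p ≢ 0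
  zero-in-long-cycle 2≤k p z =
    three-pairs (1 + p) (pair-after-zero p z 1 (s≤s z≤n) 3<ℓ)
                        (pair-after-zero p z 2 (s≤s z≤n) (≤-trans (n≤1+n 5) 5<ℓ))
                        (pair-after-zero p z 3 (s≤s z≤n) 5<ℓ)
    where
    5<ℓ : 5 < 4 + k
    5<ℓ = +-monoʳ-≤ 4 2≤k

  no-zero : ∀ p → w p ≢ 0
  no-zero p with length-cases k
  ... | inj₁ k≡0        = zero-in-4-cycle k≡0 p
  ... | inj₂ (inj₁ k≡1) = zero-in-5-cycle k≡1 p
  ... | inj₂ (inj₂ 2≤k) = zero-in-long-cycle 2≤k p

  impossible : ⊥
  impossible = three-pairs 0 (pair 0) (pair 1) (pair 2)
    where
    pair : ∀ i → PairWindow t (w i) (w (1 + i)) (w (2 + i))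
    pair i = pair-window i (no-zero i) (no-zero (1 + i)) (no-zero (2 + i))

labels : ℕ → ℕ
labels t = suc (hub t + 2 * t)

high-mono : ∀ {t p q} → High t p → p ≤ q → High t q
high-mono (high 2t<p) p≤q = high (<-≤-trans 2t<p p≤q)

LabelTriple : Set
LabelTriple = ℕ × ℕ × ℕ

Valid : ℕ → LabelTriple → Set
Valid t (a , b , c) = a < b × b < c × c < labels t × Window t a b c

-- The edges are listed in rows: row a b s m stands for the m triples
-- (a, b, s), (a, b, s + 1), …, (a, b, s + m - 1).
record Row : Set where
  constructor row
  field
    first second start size : ℕ
open Row

rowTriples : Row → List LabelTriple
rowTriples (row a b s m) = applyUpTo (λ k → a , b , s + k) m

triplesOf : List Row → List LabelTriple
triplesOf = concatMap rowTriples

rowCount : List Row → ℕ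
rowCount rs = sum (map size rs)

fan : (t a b₀ s m : ℕ) → List Row
fan t a b₀ s m = applyUpTo (λ i → row a (b₀ + i) (s + i) (labels t ∸ (s + i))) m

-- Star edges {0, 1+i, c} with c ≥ 3+i (so c is never the mate of 1+i).
starRows : ℕ → List Row
starRows t = fan t 0 1 3 (2 * t)

pairRows : ℕ → List Row
pairRows t = applyUpTo (λ j → row (suc (2 * j)) (suc (suc (2 * j))) (hub t) (suc (2 * t))) t

hubRows : ℕ → List Row
hubRows t = fan t (hub t) (1 + hub t) (2 + hub t) (2 * t)

edgeRows : ℕ → List Row
edgeRows t = starRows t ++ pairRows t ++ hubRows t

length-triplesOf : ∀ rs → length (triplesOf rs) ≡ rowCount rs
length-triplesOf []                   = refl
length-triplesOf (r@(row _ _ _ m) ∷ rs) =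
  trans (length-++ (rowTriples r)) (cong₂ _+_ (length-applyUpTo _ m) (length-triplesOf rs))

rowCount-++ : ∀ xs ys → rowCount (xs ++ ys) ≡ rowCount xs + rowCount ys
rowCount-++ xs ys = trans (cong sum (map-++ size xs ys)) (sum-++ (map size xs) (map size ys))

sum-applyUpTo-suc : ∀ f m → sum (applyUpTo f (suc m)) ≡ sum (applyUpTo f m) + f m
sum-applyUpTo-suc f m = begin
  sum (applyUpTo f (suc m))            ≡⟨ cong sum (applyUpTo-∷ʳ f m) ⟨
  sum (applyUpTo f m ++ [ f m ])       ≡⟨ sum-++ (applyUpTo f m) [ f m ] ⟩
  sum (applyUpTo f m) + (f m + 0)      ≡⟨ cong (sum (applyUpTo f m) +_) (+-identityʳ (f m)) ⟩
  sum (applyUpTo f m) + f m            ∎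
  where open ≡-Reasoning

sum-constant : ∀ c m → sum (applyUpTo (λ _ → c) m) ≡ m * c
sum-constant c zero    = refl
sum-constant c (suc m) = cong (c +_) (sum-constant c m)

-- Σ_{i<m} (N - s - i), doubled and without subtraction.
descending-sum : ∀ N s m → s + m ≤ suc N →
  2 * sum (applyUpTo (λ i → N ∸ (s + i)) m) + m * (s + s + m) ≡ m * (N + N + 1)
descending-sum N s zero    _         = refl
descending-sum N s (suc m) s+m<1+N = begin
    2 * sum (applyUpTo f (suc m)) + suc m * (s + s + suc m)
  ≡⟨ cong (λ x → 2 * x + suc m * (s + s + suc m)) (sum-applyUpTo-suc f m) ⟩
    2 * (S + f m) + suc m * (s + s + suc m)
  ≡⟨ solve 4 (λ S X s m → con 2 :* (S :+ X) :+ (con 1 :+ m) :* (s :+ s :+ (con 1 :+ m))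
                 := (con 2 :* S :+ m :* (s :+ s :+ m)) :+ con 2 :* (X :+ (s :+ m)) :+ con 1)
             refl S (f m) s m ⟩
    (2 * S + m * (s + s + m)) + 2 * (f m + (s + m)) + 1
  ≡⟨ cong₂ (λ x y → x + 2 * y + 1) (descending-sum N s m (<⇒≤ s+m<1+N′)) (m∸n+n≡m s+m≤N) ⟩
    m * (N + N + 1) + 2 * N + 1
  ≡⟨ solve 2 (λ m N → m :* (N :+ N :+ con 1) :+ con 2 :* N :+ con 1
                 := (con 1 :+ m) :* (N :+ N :+ con 1)) refl m N ⟩
    suc m * (N + N + 1) ∎
  where
  open ≡-Reasoning
  open +-*-Solver
  f : ℕ → ℕ
  f i = N ∸ (s + i)
  S : ℕ
  S = sum (applyUpTo f m)
  s+m<1+N′ : s + m < suc N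
  s+m<1+N′ = subst (_≤ suc N) (+-suc s m) s+m<1+N
  s+m≤N : s + m ≤ N
  s+m≤N = s≤s⁻¹ s+m<1+N′

fan-count : ∀ t a b₀ s m → s + m ≤ suc (labels t) →
  2 * rowCount (fan t a b₀ s m) + m * (s + s + m) ≡ m * (labels t + labels t + 1)
fan-count t a b₀ s m bound =
  trans (cong (λ xs → 2 * sum xs + m * (s + s + m)) (map-applyUpTo _ size m))
        (descending-sum (labels t) s m bound)

-- The construction has exactly 10t² - t edges: twice the star and hub
-- fans are computed by descending-sum, the pair rows have 2t+1 edges each.
edge-count : ∀ t → rowCount (edgeRows t) + t ≡ 10 * (t * t)
edge-count t = *-cancelˡ-≡ _ _ 2 (+-cancelʳ-≡ (Y₁ + Y₃) _ _ (begin
    2 * (rowCount (edgeRows t) + t) + (Y₁ + Y₃)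
  ≡⟨ cong (λ x → 2 * (x + t) + (Y₁ + Y₃))
       (trans (rowCount-++ (starRows t) _) (cong (S₁ +_) (rowCount-++ (pairRows t) (hubRows t)))) ⟩
    2 * (S₁ + (S₂ + S₃) + t) + (Y₁ + Y₃)
  ≡⟨ solve 6 (λ S₁ S₂ S₃ t Y₁ Y₃ →
         con 2 :* (S₁ :+ (S₂ :+ S₃) :+ t) :+ (Y₁ :+ Y₃)
       := (con 2 :* S₁ :+ Y₁) :+ (con 2 :* S₃ :+ Y₃) :+ con 2 :* S₂ :+ con 2 :* t) refl S₁ S₂ S₃ t Y₁ Y₃ ⟩
    (2 * S₁ + Y₁) + (2 * S₃ + Y₃) + 2 * S₂ + 2 * t
  ≡⟨ cong₂ (λ x y → x + y + 2 * S₂ + 2 * t) stars hubs ⟩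
    F + F + 2 * S₂ + 2 * t
  ≡⟨ cong (λ z → F + F + 2 * z + 2 * t) pairs ⟩
    F + F + 2 * (t * suc (2 * t)) + 2 * t
  ≡⟨ solve 1 (λ t → let T = con 2 :* t ; s₃ = con 2 :+ (con 1 :+ T) ; K = con 1 :+ ((con 1 :+ T) :+ T)
                    in T :* (K :+ K :+ con 1) :+ T :* (K :+ K :+ con 1) :+ con 2 :* (t :* (con 1 :+ T)) :+ T
                       := con 2 :* (con 10 :* (t :* t)) :+ (T :* (con 6 :+ T) :+ T :* (s₃ :+ s₃ :+ T)))
             refl t ⟩
    2 * (10 * (t * t)) + (Y₁ + Y₃) ∎))
  where
  open +-*-Solver
  open ≡-Reasoning
  S₁ S₂ S₃ Y₁ Y₃ F : ℕ
  S₁ = rowCount (starRows t)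
  S₂ = rowCount (pairRows t)
  S₃ = rowCount (hubRows t)
  Y₁ = 2 * t * (3 + 3 + 2 * t)
  Y₃ = 2 * t * ((2 + hub t) + (2 + hub t) + 2 * t)
  F = 2 * t * (labels t + labels t + 1)
  stars : 2 * S₁ + Y₁ ≡ F
  stars = fan-count t 0 1 3 (2 * t) (s≤s (s≤s (s≤s (m≤m+n (2 * t) (2 * t)))))
  hubs : 2 * S₃ + Y₃ ≡ F
  hubs = fan-count t (hub t) (1 + hub t) (2 + hub t) (2 * t) ≤-refl
  pairs : S₂ ≡ t * suc (2 * t)
  pairs = trans (cong sum (map-applyUpTo _ size t)) (sum-constant (suc (2 * t)) t)

+-<-∸ : ∀ {N s k} → k < N ∸ s → s + k < N
+-<-∸ {N}     {zero}  k<N   = k<N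
+-<-∸ {suc N} {suc s} k<N∸s = s≤s (+-<-∸ {N} {s} k<N∸s)

row-valid : ∀ {t} a b s m → (∀ k → k < m → Valid t (a , b , s + k)) → All (Valid t) (rowTriples (row a b s m))
row-valid a b s m valid = All.applyUpTo⁺₁ _ m (λ {k} k<m → valid k k<m)

fan-valid : ∀ {t} a b₀ s m → (∀ i → i < m → ∀ k → s + i + k < labels t → Valid t (a , b₀ + i , s + i + k)) →
            All (λ r → All (Valid t) (rowTriples r)) (fan t a b₀ s m)
fan-valid {t} a b₀ s m valid =
  All.applyUpTo⁺₁ _ m (λ {i} i<m → row-valid a (b₀ + i) (s + i) _
    (λ k k<m → valid i i<m k (+-<-∸ k<m)))

-- Each listed triple is a valid edge: star edges avoid matched pairs
-- since mates are consecutive, pair and hub edges are valid by construction.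
star-valid : ∀ t i → i < 2 * t → ∀ k → 3 + i + k < labels t → Valid t (0 , 1 + i , 3 + i + k)
star-valid t i i<2t k bound =
  s≤s z≤n , s≤s (s≤s (≤-trans (m≤m+n i k) (n≤1+n _))) , bound , star₁ refl (not-mates , not-highs)
  where
  not-mates : ¬ Mate t (1 + i) (3 + i + k)
  not-mates m = <⇒≱ (m≤m+n (3 + i) k) (mate-close m)
  not-highs : ¬ (High t (1 + i) × High t (3 + i + k))
  not-highs (h , _) = high-not-low h (low (s≤s z≤n) i<2t)

pair-valid : ∀ t j → j < t → ∀ k → k < suc (2 * t) →
             Valid t (suc (2 * j) , suc (suc (2 * j)) , hub t + k)
pair-valid t j j<t k k<2t+1 =
  ≤-refl , s≤s (≤-trans (pair-top j<t) (m≤m+n (2 * t) k)) ,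
  s≤s (s≤s (+-monoʳ-≤ (2 * t) (s≤s⁻¹ k<2t+1))) ,
  pair₃ (high-mono (high-hub t) (m≤m+n (hub t) k)) (j , j<t , inj₁ (refl , refl))

hub-valid : ∀ t i → i < 2 * t → ∀ k → 2 + hub t + i + k < labels t →
            Valid t (hub t , 1 + hub t + i , 2 + hub t + i + k)
hub-valid t i _ k bound =
  s≤s (m≤m+n (hub t) i) , s≤s (s≤s (m≤m+n (hub t + i) k)) , bound ,
  hub-edge (high-hub t) (high-mono (high-hub t) (≤-trans (m≤n+m (hub t) 1) (m≤m+n _ i)))
           (high-mono (high-hub t) (≤-trans (m≤n+m (hub t) 2) (≤-trans (m≤m+n _ i) (m≤m+n _ k))))
           (inj₁ refl)

RowsValid : ℕ → List Row → Set
RowsValid t rs = All (λ r → All (Valid t) (rowTriples r)) rs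

edgeRows-valid : ∀ t → All (Valid t) (triplesOf (edgeRows t))
edgeRows-valid t = All.concat⁺ (All.map⁺ (All.++⁺ stars (All.++⁺ pairs hubs)))
  where
  stars : RowsValid t (starRows t)
  stars = fan-valid 0 1 3 (2 * t) (λ i i<2t → star-valid t i i<2t)
  pairs : RowsValid t (pairRows t)
  pairs = All.applyUpTo⁺₁ _ t (λ {j} j<t → row-valid _ _ (hub t) _ (pair-valid t j j<t))
  hubs : RowsValid t (hubRows t)
  hubs = fan-valid (hub t) (1 + hub t) (2 + hub t) (2 * t) (λ i i<2t → hub-valid t i i<2t)

-- Rows are told apart by their first two labels.
rowKey : Row → ℕ × ℕ
rowKey r = first r , second r

tripleKey : LabelTriple → ℕ × ℕ
tripleKey (a , b , _) = a , b

KeysDiffer : Row → Row → Set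
KeysDiffer r r′ = rowKey r ≢ rowKey r′

row-unique : ∀ r → Unique (rowTriples r)
row-unique (row a b s m) =
  Unique.applyUpTo⁺₁ _ m (λ i<j _ eq → <⇒≢ i<j (+-cancelˡ-≡ s _ _ (cong (λ x → proj₂ (proj₂ x)) eq)))

row-keys : ∀ r → All (λ x → tripleKey x ≡ rowKey r) (rowTriples r)
row-keys (row a b s m) = All.applyUpTo⁺₂ _ m (λ _ → refl)

triplesOf-unique : ∀ rs → AllPairs KeysDiffer rs → Unique (triplesOf rs)
triplesOf-unique []       []         = []
triplesOf-unique (r ∷ rs) (r≁ ∷ rs≁) =
  AllPairs.++⁺ (row-unique r) (triplesOf-unique rs rs≁) (All.map separate (row-keys r))
  where
  later-keys : ∀ rs′ → All (KeysDiffer r) rs′ →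
               All (λ y → rowKey r ≢ tripleKey y) (triplesOf rs′)
  later-keys []        []           = []
  later-keys (r′ ∷ rs′) (r≢r′ ∷ rest) =
    All.++⁺ (All.map (λ e r≡ → r≢r′ (trans r≡ e)) (row-keys r′)) (later-keys rs′ rest)
  separate : ∀ {x} → tripleKey x ≡ rowKey r → All (x ≢_) (triplesOf rs)
  separate key≡ = All.map (λ r≢y x≡y → r≢y (trans (sym key≡) (cong tripleKey x≡y)))
                          (later-keys rs r≁)

fan-keys : ∀ t a b₀ s m → AllPairs KeysDiffer (fan t a b₀ s m)
fan-keys t a b₀ s m =
  AllPairs.applyUpTo⁺₁ _ m (λ i<j _ eq → <⇒≢ i<j (+-cancelˡ-≡ b₀ _ _ (cong proj₂ eq)))

pairRows-keys : ∀ t → AllPairs KeysDiffer (pairRows t)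
pairRows-keys t =
  AllPairs.applyUpTo⁺₁ _ t (λ i<j _ eq → <⇒≢ i<j (*-cancelˡ-≡ _ _ 2 (suc-injective (cong proj₁ eq))))

firsts-apart : ∀ {P Q : ℕ → Set} {xs ys} → (∀ {x y} → P x → Q y → x ≢ y) →
               All (λ r → P (first r)) xs → All (λ r → Q (first r)) ys →
               All (λ r → All (KeysDiffer r) ys) xs
firsts-apart apart Pxs Qys =
  All.map (λ px → All.map (λ qy eq → apart px qy (cong proj₁ eq)) Qys) Pxs

-- All rows have distinct keys: the three families are separated by their
-- first labels (0, below the hub, the hub).
edgeRows-keys : ∀ t → AllPairs KeysDiffer (edgeRows t)
edgeRows-keys t =
  AllPairs.++⁺ (fan-keys t 0 1 3 (2 * t))
               (AllPairs.++⁺ (pairRows-keys t) (fan-keys t (hub t) (1 + hub t) (2 + hub t) (2 * t))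
                             (firsts-apart (λ x<hub y≡hub x≡y → <⇒≢ x<hub (trans x≡y y≡hub))
                                           pairs-below-hub hubs-at-hub))
               (firsts-apart (λ x≡0 0<y x≡y → <⇒≢ 0<y (trans (sym x≡0) x≡y))
                             stars-at-0 (All.++⁺ pairs-positive hubs-positive))
  where
  stars-at-0 : All (λ r → first r ≡ 0) (starRows t)
  stars-at-0 = All.applyUpTo⁺₂ _ (2 * t) (λ _ → refl)
  pairs-positive : All (λ r → 0 < first r) (pairRows t)
  pairs-positive = All.applyUpTo⁺₂ _ t (λ _ → s≤s z≤n)
  pairs-below-hub : All (λ r → first r < hub t) (pairRows t)
  pairs-below-hub = All.applyUpTo⁺₁ _ t (λ j<t → s≤s (≤-trans (n≤1+n _) (pair-top j<t)))
  hubs-positive : All (λ r → 0 < first r) (hubRows t)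
  hubs-positive = All.applyUpTo⁺₂ _ (2 * t) (λ _ → s≤s z≤n)
  hubs-at-hub : All (λ r → first r ≡ hub t) (hubRows t)
  hubs-at-hub = All.applyUpTo⁺₂ _ (2 * t) (λ _ → refl)

shift-% : ∀ L .{{_ : NonZero L}} i d → d < L → (d + i) % L ≡ (d + i % L) % L
shift-% L i d d<L = trans (%-distribˡ-+ d i L) (cong (λ x → (x + i % L) % L) (m<n⇒m%n≡m d<L))

residues-differ : ∀ L .{{_ : NonZero L}} i d → 0 < d → d < L → i % L ≢ (d + i) % L
residues-differ L i d 0<d d<L eq with d + i % L <? L
... | yes small = <⇒≢ 0<d (+-cancelʳ-≡ (i % L) 0 d (trans (trans eq (shift-% L i d d<L)) (m<n⇒m%n≡m small)))
... | no large  = <⇒≢ d<L (sym (+-cancelˡ-≡ (i % L) L d (begin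
      i % L + L                     ≡⟨ cong (_+ L) wrapped ⟩
      (d + i % L ∸ L) + L           ≡⟨ m∸n+n≡m L≤ ⟩
      d + i % L                     ≡⟨ +-comm d (i % L) ⟩
      i % L + d                     ∎)))
  where
  open ≡-Reasoning
  L≤ : L ≤ d + i % L
  L≤ = ≮⇒≥ large
  wrapped : i % L ≡ d + i % L ∸ L
  wrapped = begin
    i % L                    ≡⟨ trans eq (shift-% L i d d<L) ⟩
    (d + i % L) % L          ≡⟨ m≤n⇒[n∸m]%m≡n%m L≤ ⟨
    (d + i % L ∸ L) % L      ≡⟨ m<n⇒m%n≡m (m<n+o⇒m∸n<o (d + i % L) L (+-mono-< d<L (m%n<n i L))) ⟩
    d + i % L ∸ L            ∎

toℕ-mod : ∀ m n .{{_ : NonZero n}} → toℕ (m mod n) ≡ m % n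
toℕ-mod m n = toℕ-fromℕ< (m%n<n m n)

mod-step : ∀ L .{{_ : NonZero L}} j d → (toℕ (j mod L) + d) mod L ≡ (d + j) mod L
mod-step L j d = toℕ-injective (begin
    toℕ ((toℕ (j mod L) + d) mod L)   ≡⟨ toℕ-mod _ L ⟩
    (toℕ (j mod L) + d) % L           ≡⟨ cong (λ x → (x + d) % L) (toℕ-mod j L) ⟩
    (j % L + d) % L                   ≡⟨ %-distribˡ-+ (j % L) d L ⟩
    (j % L % L + d % L) % L           ≡⟨ cong (λ x → (x + d % L) % L) (m%n%n≡m%n j L) ⟩
    (j % L + d % L) % L               ≡⟨ %-distribˡ-+ j d L ⟨
    (j + d) % L                       ≡⟨ cong (_% L) (+-comm j d) ⟩
    (d + j) % L                       ≡⟨ toℕ-mod (d + j) L ⟨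
    toℕ ((d + j) mod L)               ∎)
  where open ≡-Reasoning

mod-period : ∀ L .{{_ : NonZero L}} i → (L + i) mod L ≡ i mod L
mod-period L i = toℕ-injective (begin
    toℕ ((L + i) mod L)   ≡⟨ toℕ-mod (L + i) L ⟩
    (L + i) % L           ≡⟨ cong (_% L) (+-comm L i) ⟩
    (i + L) % L           ≡⟨ [m+n]%n≡m%n i L ⟩
    i % L                 ≡⟨ toℕ-mod i L ⟨
    toℕ (i mod L)         ∎)
  where open ≡-Reasoning

valid-window : ∀ {t} x → Valid t x → Window t (proj₁ x) (proj₁ (proj₂ x)) (proj₂ (proj₂ x))
valid-window _ (_ , _ , _ , W) = W

-- The construction on Fin n (n ≥ 4t+2): the labelled edges, with labels
-- read as vertices and the remaining vertices isolated.
module Construction (t n : ℕ) {{_ : NonZero n}} (room : labels t ≤ n) where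

  encode : LabelTriple → Triple n
  encode (a , b , c) = a mod n , b mod n , c mod n

  toℕ-label : ∀ {a} → a < n → toℕ (a mod n) ≡ a
  toℕ-label {a} a<n = trans (toℕ-mod a n) (m<n⇒m%n≡m a<n)

  valid-bounds : ∀ {a b c} → Valid t (a , b , c) → a < n × b < n × c < n
  valid-bounds (a<b , b<c , c<K , _) = <-trans a<b b<n , b<n , c<n
    where
    c<n : _ < n
    c<n = <-≤-trans c<K room
    b<n : _ < n
    b<n = <-trans b<c c<n

  encode-sorted : ∀ x → Valid t x → Sorted3 (encode x)
  encode-sorted (a , b , c) valid@(a<b , b<c , _) =
    let a<n , b<n , c<n = valid-bounds valid
    in subst₂ _<_ (sym (toℕ-label a<n)) (sym (toℕ-label b<n)) a<b ,
       subst₂ _<_ (sym (toℕ-label b<n)) (sym (toℕ-label c<n)) b<c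

  encode-injective : ∀ {x y} → Valid t x → Valid t y → encode x ≡ encode y → x ≡ y
  encode-injective {a , b , c} {a′ , b′ , c′} valid valid′ eq =
    let a<n , b<n , c<n = valid-bounds valid
        a′<n , b′<n , c′<n = valid-bounds valid′
    in cong₂ _,_ (same a<n a′<n (cong proj₁ eq))
                 (cong₂ _,_ (same b<n b′<n (cong (λ e → proj₁ (proj₂ e)) eq))
                            (same c<n c′<n (cong (λ e → proj₂ (proj₂ e)) eq)))
    where
    same : ∀ {u v} → u < n → v < n → u mod n ≡ v mod n → u ≡ v
    same u<n v<n e = trans (sym (toℕ-label u<n)) (trans (cong toℕ e) (toℕ-label v<n))

  triples : List LabelTriple
  triples = triplesOf (edgeRows t)

  encoded-distinct : AllPairs (λ x y → encode x ≢ encode y) triples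
  encoded-distinct = distinct-codes (edgeRows-valid t) (triplesOf-unique (edgeRows t) (edgeRows-keys t))
    where
    distinct-codes : ∀ {xs} → All (Valid t) xs → AllPairs _≢_ xs → AllPairs (λ x y → encode x ≢ encode y) xs
    distinct-codes []             []          = []
    distinct-codes (vx ∷ valids) (x≢ ∷ rest) =
      All.zipWith (λ (vy , x≢y) e → x≢y (encode-injective vx vy e)) (valids , x≢) ∷ distinct-codes valids rest

  construction : Hypergraph3 n
  construction = hg (map encode triples)
                    (All.map⁺ (All.map (λ {x} → encode-sorted x) (edgeRows-valid t)))
                    (AllPairs.map⁺ encoded-distinct)

  construction-size : numEdges construction + t ≡ 10 * (t * t)
  construction-size = begin
    length (map encode triples) + t   ≡⟨ cong (_+ t) (length-map encode triples) ⟩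
    length triples + t                ≡⟨ cong (_+ t) (length-triplesOf (edgeRows t)) ⟩
    rowCount (edgeRows t) + t         ≡⟨ edge-count t ⟩
    10 * (t * t)                      ∎
    where open ≡-Reasoning

  edge-window : ∀ {x y z} → IsEdge construction x y z → Window t (toℕ x) (toℕ y) (toℕ z)
  edge-window (x≢y , y≢z , x≢z , found) =
    let valid , x∈ , y∈ , z∈ = All.lookupAny (edgeRows-valid t) (Any.map⁻ found)
    in window-reorder (valid-window _ valid) (toℕ-≢ x≢y) (toℕ-≢ y≢z) (toℕ-≢ x≢z)
                      (member valid x∈) (member valid y∈) (member valid z∈)
    where
    toℕ-≢ : ∀ {u v : Fin n} → u ≢ v → toℕ u ≢ toℕ v
    toℕ-≢ u≢v e = u≢v (toℕ-injective e)
    member : ∀ {v a b c} → Valid t (a , b , c) → InTriple v (encode (a , b , c)) → OneOf (toℕ v) a b c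
    member valid =
      let a<n , b<n , c<n = valid-bounds valid
      in Sum.map (label a<n) (Sum.map (label b<n) (label c<n))
      where
      label : ∀ {u} {v : Fin n} → u < n → v ≡ u mod n → toℕ v ≡ u
      label u<n e = trans (cong toℕ e) (toℕ-label u<n)

  -- A tight cycle v on n vertices gives a periodic label sequence all of
  -- whose windows are edges, which TightCycle rules out.
  construction-tight-cycle-free : TightCycleFree construction
  construction-tight-cycle-free k (v , v-injective , edge) =
    TightCycle.impossible t k w window distinct periodic
    where
    w : ℕ → ℕ
    w j = toℕ (v (j mod (4 + k)))
    window : ∀ i → Window t (w i) (w (1 + i)) (w (2 + i))
    window i = edge-window (subst₂ (λ p q → IsEdge construction (v (i mod (4 + k))) (v p) (v q))
                                   (mod-step (4 + k) i 1) (mod-step (4 + k) i 2) (edge (i mod (4 + k))))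
    distinct : ∀ i d → 0 < d → d < 4 + k → w i ≢ w (d + i)
    distinct i d 0<d d<ℓ eq = residues-differ (4 + k) i d 0<d d<ℓ
      (trans (sym (toℕ-mod i (4 + k))) (trans (cong toℕ (v-injective (toℕ-injective eq))) (toℕ-mod (d + i) (4 + k))))
    periodic : ∀ i → w (4 + k + i) ≡ w i
    periodic i = cong (λ j → toℕ (v j)) (mod-period (4 + k) i)

two-choose : ∀ m → 2 * (m C 2) + m ≡ m * m
two-choose zero    = refl
two-choose (suc m) = begin
    2 * (suc m C 2) + suc m      ≡⟨ cong (λ x → 2 * x + suc m) (nCk+nC[k+1]≡[n+1]C[k+1] m 1) ⟨
    2 * (m C 1 + m C 2) + suc m  ≡⟨ cong (λ x → 2 * (x + m C 2) + suc m) (nC1≡n m) ⟩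
    2 * (m + m C 2) + suc m      ≡⟨ solve 2 (λ m c → con 2 :* (m :+ c) :+ (con 1 :+ m)
                                           := (con 2 :* c :+ m) :+ (con 1 :+ m :+ m)) refl m (m C 2) ⟩
    (2 * (m C 2) + m) + (suc m + m) ≡⟨ cong (_+ (suc m + m)) (two-choose m) ⟩
    m * m + (suc m + m)          ≡⟨ solve 1 (λ m → m :* m :+ (con 1 :+ m :+ m) := (con 1 :+ m) :* (con 1 :+ m)) refl m ⟩
    suc m * suc m                ∎
  where
  open ≡-Reasoning
  open +-*-Solver

edge-bound : ∀ t m E → t * 4 ≤ m → m ≤ 3 + t * 4 → E + t ≡ 10 * (t * t) →
             6 * (suc m C 2) ≤ 5 * (E + 10 * (2 + m))
edge-bound t m E lower upper count = *-cancelˡ-≤ 2 (+-cancelʳ-≤ (10 * t) _ _ (begin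
    2 * (6 * B) + 10 * t
  ≡⟨ cong (_+ 10 * t) (solve 1 (λ c → con 2 :* (con 6 :* c) := con 6 :* (con 2 :* c)) refl B) ⟩
    6 * (2 * B) + 10 * t
  ≤⟨ +-monoˡ-≤ (10 * t) (*-monoʳ-≤ 6 (m≤m+n (2 * B) (suc m))) ⟩
    6 * (2 * B + suc m) + 10 * t
  ≡⟨ cong (λ x → 6 * x + 10 * t) (two-choose (suc m)) ⟩
    6 * (suc m * suc m) + 10 * t
  ≤⟨ +-monoˡ-≤ (10 * t) (*-monoʳ-≤ 6 (*-mono-≤ (s≤s upper) (s≤s upper))) ⟩
    6 * ((4 + t * 4) * (4 + t * 4)) + 10 * t
  ≤⟨ m≤m+n _ (4 * (t * t) + 198 * t + 104) ⟩
    6 * ((4 + t * 4) * (4 + t * 4)) + 10 * t + (4 * (t * t) + 198 * t + 104)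
  ≡⟨ solve 1 (λ t → con 6 :* ((con 4 :+ t :* con 4) :* (con 4 :+ t :* con 4)) :+ con 10 :* t
                      :+ (con 4 :* (t :* t) :+ con 198 :* t :+ con 104)
                  := con 10 :* (con 10 :* (t :* t)) :+ con 100 :* (con 2 :+ t :* con 4)) refl t ⟩
    10 * (10 * (t * t)) + 100 * (2 + t * 4)
  ≤⟨ +-monoʳ-≤ (10 * (10 * (t * t))) (*-monoʳ-≤ 100 (+-monoʳ-≤ 2 lower)) ⟩
    10 * (10 * (t * t)) + 100 * (2 + m)
  ≡⟨ cong (λ x → 10 * x + 100 * (2 + m)) count ⟨
    10 * (E + t) + 100 * (2 + m)
  ≡⟨ solve 3 (λ E t m → con 10 :* (E :+ t) :+ con 100 :* (con 2 :+ m)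
                      := con 2 :* (con 5 :* (E :+ con 10 :* (con 2 :+ m))) :+ con 10 :* t) refl E t m ⟩
    2 * (5 * (E + 10 * (2 + m))) + 10 * t ∎))
  where
  open ≤-Reasoning
  open +-*-Solver
  B : ℕ
  B = suc m C 2

quarter-bounds : ∀ m → m / 4 * 4 ≤ m × m ≤ 3 + m / 4 * 4
quarter-bounds m =
  m/n*n≤m m 4 ,
  subst (_≤ 3 + m / 4 * 4) (sym (m≡m%n+[m/n]*n m 4)) (+-monoˡ-≤ (m / 4 * 4) (s≤s⁻¹ (m%n<n m 4)))

labels-fit : ∀ m → labels (m / 4) ≤ 2 + m
labels-fit m = s≤s (s≤s (subst (_≤ m) four-t (proj₁ (quarter-bounds m))))
  where
  open +-*-Solver
  four-t : m / 4 * 4 ≡ 2 * (m / 4) + 2 * (m / 4)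
  four-t = solve 1 (λ t → t :* con 4 := con 2 :* t :+ con 2 :* t) refl (m / 4)

theorem3p2 : Σ ℕ λ K → 0 < K × Σ ℕ λ N → (n : ℕ) → N ≤ n →
    Σ (Hypergraph3 n) λ H → TightCycleFree H ×
      6 * ((n ∸ 1) C 2) ≤ 5 * (numEdges H + K * n)
theorem3p2 = 10 , s≤s z≤n , 2 , large
  where
  large : (n : ℕ) → 2 ≤ n → Σ (Hypergraph3 n) λ H → TightCycleFree H ×
            6 * ((n ∸ 1) C 2) ≤ 5 * (numEdges H + 10 * n)
  large (suc zero) (s≤s ())
  large (suc (suc m)) _ =
    let lower , upper = quarter-bounds m
        open Construction (m / 4) (2 + m) (labels-fit m)
    in construction , construction-tight-cycle-free ,
       edge-bound (m / 4) m (numEdges construction) lower upper construction-size
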